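{- Let $\mathbb{A} = (X, \leq, \mathcal{M})$ be a direct presentation and let $\mathcal{D}(X,\leq)$ be the set of downsets of $(X,\leq)$. Then for every $S \in \mathcal{D}(X,\leq)$ the set $\overline{cl}_{\mathbb{A}}(S) := \{ x \in X \mid D \subseteq S \text{ for some } D \in \mathcal{M}(x)\}$ is again a downset of $(X,\leq)$, and the resulting map $\overline{cl}_{\mathbb{A}} : \mathcal{D}(X,\leq) \to \mathcal{D}(X,\leq)$ is a closure operator, i.e.\ it is order-preserving with respect to $\subseteq$, and $S \subseteq \overline{cl}_{\mathbb{A}}(S)$ and $\overline{cl}_{\mathbb{A}}(\overline{cl}_{\mathbb{A}}(S)) \subseteq \overline{cl}_{\mathbb{A}}(S)$ for every $S \in \mathcal{D}(X,\leq)$.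
   Context: For a poset $(X,\leq)$, the refinement relation $\ll$ on subsets of $X$ is defined by: $A \ll B$ iff for every $a \in A$ there is some $b \in B$ with $a \leq b$ (equivalently ${\downarrow}A \subseteq {\downarrow}B$, where ${\downarrow}C = \{x \in X \mid x \leq c \text{ for some } c \in C\}$). A downset of $(X,\leq)$ is a subset $S\subseteq X$ such that $y \leq x$ and $x \in S$ imply $y \in S$. A presentation is a triple $(X,\leq,\mathcal{M})$ where $(X,\leq)$ is a poset and $\mathcal{M} : X \to \mathcal{P}\mathcal{P}X$. It is monotone if whenever $y \leq x$ and $C \in \mathcal{M}(x)$, there is some $D \in \mathcal{M}(y)$ with $D \ll C$; reflexive if for each $x \in X$ there is some $C \in \mathcal{M}(x)$ with $C \ll \{x\}$; transitive if for every $x \in X$ and every $C \in \mathcal{M}(x)$, and every family $\{D_c \mid c \in C\}$ with $D_c \in \mathcal{M}(c)$ for each $c \in C$, there is some $E \in \mathcal{M}(x)$ with $E \ll \bigcup_{c \in C} D_c$; direct if it is monotone, reflexive and transitive. -}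

module Defs where

open import Level using (Level; suc)
open import Data.Product using (Σ; ∃; ∃-syntax; _×_; _,_)
open import Relation.Binary.Bundles using (Poset)
open import Relation.Unary using (Pred; _⊆_; _∈_)

-- Predicative setting: carrier, order, equality, subsets and index sets all live
-- in the same universe level c, so that cl̄ maps subsets to subsets.
module _ {c : Level} (P : Poset c c c) where
  open Poset P renaming (Carrier to X)

  Subset : Set (suc c)
  Subset = Pred X c

  _≪_ : Subset → Subset → Set c
  A ≪ B = ∀ a → a ∈ A → ∃[ b ] (b ∈ B × a ≤ b)

  ｛_｝ : X → Subset
  ｛ x ｝ = λ y → y ≈ x

  IsDownset : Subset → Set c
  IsDownset S = ∀ {x y} → y ≤ x → S x → S y

  -- A map M : X → P(P X), with each M(x) given as an indexed family of subsets
  -- (index set Idx x, members Mem x i).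
  record Presentation : Set (suc c) where
    field
      Idx : X → Set c
      Mem : (x : X) → Idx x → Subset

  module _ (M : Presentation) where
    open Presentation M

    Monotone : Set c
    Monotone = ∀ x y → y ≤ x → (i : Idx x) → ∃[ j ] (Mem y j ≪ Mem x i)

    Reflexive : Set c
    Reflexive = ∀ x → ∃[ i ] (Mem x i ≪ ｛ x ｝)

    -- For C ∈ M(x) and a choice D_y ∈ M(y) for each y ∈ C (given by indices),
    -- some E ∈ M(x) refines ⋃_{y ∈ C} D_y.
    Transitive : Set c
    Transitive = ∀ x (i : Idx x) (d : (y : X) → y ∈ Mem x i → Idx y) →
      ∃[ k ] (Mem x k ≪ (λ z → ∃[ y ] (Σ (y ∈ Mem x i) λ h → z ∈ Mem y (d y h))))

    record IsDirect : Set c where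
      field
        monotone   : Monotone
        reflexive  : Reflexive
        transitive : Transitive

    cl : Subset → Subset
    cl S x = ∃[ i ] (Mem x i ⊆ S)

module Submission where

open import Defs
open import Level using (Level)
open import Data.Product using (Σ; ∃-syntax; _×_; _,_; proj₁; proj₂)
open import Relation.Binary.Bundles using (Poset)
open import Relation.Unary using (_⊆_; _∈_)

-- Each closure property uses exactly one axiom of a direct presentation: a
-- downset contains everything refining one of its subsets, so refinements
-- supplied by monotonicity, reflexivity and transitivity land back in S.

module _ {c : Level} (P : Poset c c c) where
  open Poset P

  ≪-⊆-downset : ∀ {A B S : Subset P} → IsDownset P S → _≪_ P A B → B ⊆ S → A ⊆ S
  ≪-⊆-downset S↓ A≪B B⊆S {a} a∈A with A≪B a a∈A
  ... | b , b∈B , a≤b = S↓ a≤b (B⊆S b∈B)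

  ｛｝-⊆-downset : ∀ {S : Subset P} {x} → IsDownset P S → S x → ｛_｝ P x ⊆ S
  ｛｝-⊆-downset S↓ x∈S y≈x = S↓ (reflexive y≈x) x∈S

  module _ (M : Presentation P) where
    open Presentation M

    cl-downset : Monotone P M → ∀ S → IsDownset P S → IsDownset P (cl P M S)
    cl-downset mono S S↓ {x} {y} y≤x (i , Mxi⊆S) with mono x y y≤x i
    ... | j , Myj≪Mxi = j , ≪-⊆-downset S↓ Myj≪Mxi Mxi⊆S

    cl-mono : ∀ {S T} → S ⊆ T → cl P M S ⊆ cl P M T
    cl-mono S⊆T (i , Mxi⊆S) = i , λ z∈Mxi → S⊆T (Mxi⊆S z∈Mxi)

    cl-inflationary : Reflexive P M → ∀ S → IsDownset P S → S ⊆ cl P M S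
    cl-inflationary M-refl S S↓ {x} x∈S with M-refl x
    ... | i , Mxi≪x = i , ≪-⊆-downset S↓ Mxi≪x (｛｝-⊆-downset S↓ x∈S)

    -- Transitivity is applied to the family choosing, for each y ∈ Mem x i,
    -- the index witnessing y ∈ cl S.
    cl-idempotent : Transitive P M → ∀ S → IsDownset P S → cl P M (cl P M S) ⊆ cl P M S
    cl-idempotent M-trans S S↓ {x} (i , Mxi⊆clS) with M-trans x i (λ y h → proj₁ (Mxi⊆clS h))
    ... | k , Mxk≪⋃ = k , ≪-⊆-downset S↓ Mxk≪⋃ ⋃⊆S
      where
      ⋃⊆S : (λ z → ∃[ y ] Σ (y ∈ Mem x i) λ h → z ∈ Mem y (proj₁ (Mxi⊆clS h))) ⊆ S
      ⋃⊆S (y , h , z∈D) = proj₂ (Mxi⊆clS h) z∈D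

mainTheorem1 : {c : Level} (P : Poset c c c) (M : Presentation P) → IsDirect P M →
    ((S : Subset P) → IsDownset P S → IsDownset P (cl P M S))
    × ((S T : Subset P) → IsDownset P S → IsDownset P T → S ⊆ T → cl P M S ⊆ cl P M T)
    × ((S : Subset P) → IsDownset P S → S ⊆ cl P M S)
    × ((S : Subset P) → IsDownset P S → cl P M (cl P M S) ⊆ cl P M S)
mainTheorem1 P M direct =
    cl-downset P M monotone
  , (λ _ _ _ _ → cl-mono P M)
  , cl-inflationary P M reflexive
  , cl-idempotent P M transitive
  where open IsDirect direct
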